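{- Let $C_m=\langle g\mid g^m=1\rangle$ and, for $\gcd(r,s,m)=1$, let $\mathcal{C}(m;r,s)=(C_m,g^r,g^s)$. Two such dessins $\mathcal{C}(m;r,s)$ and $\mathcal{C}(m;t,q)$ lie in the same orbit under the generalised Wilson operations if and only if $\gcd(r,m)=\gcd(t,m)$ and $\gcd(s,m)=\gcd(q,m)$. In particular, every such dessin is invariant (up to isomorphism) under every Wilson operation.
   Context: A regular dessin is a triple $(G,x,y)$ with $G$ a finite group generated by $x,y$, of type $(l,m',n)=(o(x),o(y),o(xy))$; $(G_1,x_1,y_1)\cong(G_2,x_2,y_2)$ if $x_1\mapsto x_2$, $y_1\mapsto y_2$ extends to a group isomorphism. For integers $i,j$ with $\gcd(i,o(x))=\gcd(j,o(y))=1$, the generalised Wilson operation $H_{i,j}$ sends $(G,x,y)$ to $(G,x^i,y^j)$; two dessins lie in the same orbit if one is isomorphic to the image of the other under some $H_{i,j}$. The Wilson operation $H_j$ is $H_{j,j}$. -}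

module Defs where

open import Data.Nat using (ℕ; _≤_; _<_)
open import Data.Nat.GCD using (gcd)
open import Data.Integer using (ℤ; +_; _+_; _-_; _*_; ∣_∣)
open import Data.Integer.Divisibility using (_∣_)
open import Data.Product using (Σ; ∃; _×_; _,_)
open import Data.Sum using (_⊎_)
open import Relation.Binary.PropositionalEquality using (_≡_)

-- The cyclic group C_m = ⟨ g | g^m = 1 ⟩ is modelled additively: the element g^a
-- is represented by the integer a, and g^a = g^b in C_m iff a ≡ b (mod m).
-- Group multiplication corresponds to +, the power (g^a)^i to i * a.
infix 4 _≡[_]_
_≡[_]_ : ℤ → ℕ → ℤ → Set
a ≡[ m ] b = (+ m) ∣ (a - b)

IsOrder : ℕ → ℤ → ℕ → Set
IsOrder m a k =
  (0 < k) × ((+ k) * a ≡[ m ] + 0) ×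
  (∀ j → 0 < j → (+ j) * a ≡[ m ] + 0 → k ≤ j)

IsAut : ℕ → (ℤ → ℤ) → Set
IsAut m f =
  (∀ a b → a ≡[ m ] b → f a ≡[ m ] f b) ×
  (∀ a b → f (a + b) ≡[ m ] (f a + f b)) ×
  (∀ a b → f a ≡[ m ] f b → a ≡[ m ] b) ×
  (∀ b → ∃ λ a → f a ≡[ m ] b)

-- A regular dessin (C_m, x, y): the pair of (exponents of) generators x, y.
Dessin : Set
Dessin = ℤ × ℤ

𝒞 : ℕ → ℤ → ℤ → Dessin
𝒞 m r s = (r , s)

Iso : ℕ → Dessin → Dessin → Set
Iso m (x₁ , y₁) (x₂ , y₂) =
  ∃ λ f → IsAut m f × (f x₁ ≡[ m ] x₂) × (f y₁ ≡[ m ] y₂)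

Admissible : ℕ → Dessin → ℤ → ℤ → Set
Admissible m (x , y) i j =
  (∀ k → IsOrder m x k → gcd (∣ i ∣) k ≡ 1) ×
  (∀ k → IsOrder m y k → gcd (∣ j ∣) k ≡ 1)

H : ℤ → ℤ → Dessin → Dessin
H i j (x , y) = (i * x , j * y)

Reaches : ℕ → Dessin → Dessin → Set
Reaches m D₁ D₂ = ∃ λ i → ∃ λ j → Admissible m D₁ i j × Iso m (H i j D₁) D₂

SameOrbit : ℕ → Dessin → Dessin → Set
SameOrbit m D₁ D₂ = Reaches m D₁ D₂ ⊎ Reaches m D₂ D₁

module Submission where

-- The whole argument rests on the
-- order of g^a, which is the cofactor m / gcd(|a|, m): the multiples of it are
-- exactly the k with m ∣ k·|a|. Since m = order · gcd, the order of g^a and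
-- gcd(|a|, m) determine each other.

open import Level using (0ℓ)
open import Data.Nat
  using (ℕ; zero; suc; _+_; _*_; _/_; _<_; NonZero; ≢-nonZero; ≢-nonZero⁻¹; >-nonZero; >-nonZero⁻¹)
open import Data.Nat.Properties using (*-comm; *-assoc; *-identityʳ; *-cancelˡ-≡; *-cancelʳ-≡; ≤-antisym)
open import Data.Nat.Divisibility
  using (_∣_; divides; ∣-refl; ∣-trans; ∣-antisym; ∣1⇒≡1; ∣⇒≤; m∣m*n; n∣m*n; *-monoʳ-∣; *-cancelˡ-∣;
         m/n∣o⇒m∣o*n; m∣n*o⇒m/n∣o)
open import Data.Nat.DivMod using (m/n*n≡m)
open import Data.Nat.GCD
  using (gcd; gcd-GCD; module Bézout; gcd[m,n]∣m; gcd[m,n]∣n; gcd-greatest; gcd[m,n]≢0;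
         c*gcd[m,n]≡gcd[cm,cn]; n/gcd[m,n]≢0)
open import Data.Nat.Coprimality using (Coprime; gcd≡1⇒coprime; coprime-divisor)
import Data.Nat.Coprimality as Coprime
open import Data.Integer using (ℤ; +_; _-_; 0ℤ; 1ℤ; ∣_∣)
import Data.Integer as ℤ
import Data.Integer.Properties as ℤ
import Data.Integer.Divisibility.Signed as ℤ
open import Data.Integer.Tactic.RingSolver using (solve-∀)
open import Data.Product using (_,_; proj₁; proj₂; _×_; ∃)
import Data.Product as Product
open import Data.Sum using (inj₁; inj₂)
open import Function.Bundles using (_⇔_; mk⇔; Equivalence)
import Function.Properties.Equivalence as Equiv
open import Relation.Binary.Bundles using (Setoid)
open import Relation.Binary.PropositionalEquality
  using (_≡_; refl; sym; trans; cong; subst; subst₂; module ≡-Reasoning)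
import Relation.Binary.Reasoning.Setoid as SetoidReasoning

open import Defs

gcd-nonZero : ∀ x n → {{_ : NonZero n}} → NonZero (gcd x n)
gcd-nonZero x n = ≢-nonZero (gcd[m,n]≢0 x n (inj₂ (≢-nonZero⁻¹ n)))

-- The cofactor n / gcd x n: the additive order of x modulo n.
cofactor : ℕ → (n : ℕ) → {{_ : NonZero n}} → ℕ
cofactor x n = _/_ n (gcd x n) {{gcd-nonZero x n}}

cofactor-nonZero : ∀ x n → {{_ : NonZero n}} → NonZero (cofactor x n)
cofactor-nonZero x n = ≢-nonZero (n/gcd[m,n]≢0 x n {{gcd≢0 = gcd-nonZero x n}})

cofactor∣⇔ : ∀ x n k → {{_ : NonZero n}} → ((cofactor x n ∣ k) ⇔ (n ∣ k * x))
cofactor∣⇔ x n k = mk⇔ to from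
  where
  instance _ = gcd-nonZero x n
  to : cofactor x n ∣ k → n ∣ k * x
  to h = ∣-trans (m/n∣o⇒m∣o*n (gcd[m,n]∣n x n) h) (*-monoʳ-∣ k (gcd[m,n]∣m x n))
  -- n divides both k * x and k * n, hence their gcd k * gcd x n
  from : n ∣ k * x → cofactor x n ∣ k
  from h = m∣n*o⇒m/n∣o (gcd[m,n]∣n x n)
    (subst (n ∣_) (sym (c*gcd[m,n]≡gcd[cm,cn] k x n)) (gcd-greatest h (n∣m*n k)))

cofactor*gcd≡n : ∀ x n → {{_ : NonZero n}} → cofactor x n * gcd x n ≡ n
cofactor*gcd≡n x n = m/n*n≡m {{gcd-nonZero x n}} (gcd[m,n]∣n x n)

cofactor≡⇒gcd≡ : ∀ x y n → {{_ : NonZero n}} → cofactor x n ≡ cofactor y n → gcd x n ≡ gcd y n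
cofactor≡⇒gcd≡ x y n eq = *-cancelˡ-≡ (gcd x n) (gcd y n) (cofactor x n) {{cofactor-nonZero x n}} (begin
  cofactor x n * gcd x n ≡⟨ cofactor*gcd≡n x n ⟩
  n                      ≡⟨ sym (cofactor*gcd≡n y n) ⟩
  cofactor y n * gcd y n ≡⟨ cong (_* gcd y n) (sym eq) ⟩
  cofactor x n * gcd y n ∎)
  where open ≡-Reasoning

gcd≡⇒cofactor≡ : ∀ x y n → {{_ : NonZero n}} → gcd x n ≡ gcd y n → cofactor x n ≡ cofactor y n
gcd≡⇒cofactor≡ x y n eq = *-cancelʳ-≡ (cofactor x n) (cofactor y n) (gcd y n) {{gcd-nonZero y n}} (begin
  cofactor x n * gcd y n ≡⟨ cong (cofactor x n *_) (sym eq) ⟩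
  cofactor x n * gcd x n ≡⟨ cofactor*gcd≡n x n ⟩
  n                      ≡⟨ sym (cofactor*gcd≡n y n) ⟩
  cofactor y n * gcd y n ∎)
  where open ≡-Reasoning

same-multiples⇒≡ : ∀ {a b} → (∀ k → a ∣ k → b ∣ k) → (∀ k → b ∣ k → a ∣ k) → a ≡ b
same-multiples⇒≡ {a} {b} a⇒b b⇒a = ∣-antisym (b⇒a b ∣-refl) (a⇒b a ∣-refl)

coprime⇒cancellable : ∀ {i n} → gcd i n ≡ 1 → ∀ k → n ∣ k * i → n ∣ k
coprime⇒cancellable {i} {n} i⊥n k n∣ki =
  coprime-divisor (Coprime.sym (gcd≡1⇒coprime {i} {n} i⊥n)) (subst (n ∣_) (*-comm k i) n∣ki)

-- Conversely, cancelling i from n ∣ (n / gcd i n) * i gives n ∣ n / gcd i n,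
-- so gcd i n = 1.
cancellable⇒coprime : ∀ i n → {{_ : NonZero n}} → (∀ k → n ∣ k * i → n ∣ k) → gcd i n ≡ 1
cancellable⇒coprime i n cancel =
  ∣1⇒≡1 (*-cancelˡ-∣ (cofactor i n) {{cofactor-nonZero i n}}
          (subst₂ _∣_ (sym (cofactor*gcd≡n i n)) (sym (*-identityʳ (cofactor i n))) n∣cofactor))
  where
  n∣cofactor : n ∣ cofactor i n
  n∣cofactor = cancel (cofactor i n) (Equivalence.to (cofactor∣⇔ i n (cofactor i n)) ∣-refl)

-- If j is coprime to the cofactor n / gcd x n, then gcd j n divides the
-- complementary factor gcd x n, hence x.
coprime-to-cofactor⇒gcd∣ : ∀ j x n → {{_ : NonZero n}} → gcd j (cofactor x n) ≡ 1 → gcd j n ∣ x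
coprime-to-cofactor⇒gcd∣ j x n j⊥cofactor =
  ∣-trans (coprime-divisor gcd⊥cofactor gcd∣cofactor*gcd) (gcd[m,n]∣m x n)
  where
  gcd⊥cofactor : Coprime (gcd j n) (cofactor x n)
  gcd⊥cofactor (d∣gcd , d∣cofactor) = ∣1⇒≡1 (subst (_ ∣_) j⊥cofactor
    (gcd-greatest (∣-trans d∣gcd (gcd[m,n]∣m j n)) d∣cofactor))
  gcd∣cofactor*gcd : gcd j n ∣ cofactor x n * gcd x n
  gcd∣cofactor*gcd = subst (gcd j n ∣_) (sym (cofactor*gcd≡n x n)) (gcd[m,n]∣n j n)

abs-sign : ∀ a → ∃ λ e → (+ ∣ a ∣ ≡ e ℤ.* a) × (a ≡ e ℤ.* + ∣ a ∣)
abs-sign a with ℤ.+∣i∣≡i⊎+∣i∣≡-i a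
... | inj₁ |a|≡a  = 1ℤ , trans |a|≡a (sym (ℤ.*-identityˡ a)) ,
                     sym (trans (ℤ.*-identityˡ (+ ∣ a ∣)) |a|≡a)
... | inj₂ |a|≡-a = ℤ.-1ℤ , trans |a|≡-a (sym (ℤ.-1*i≡-i a)) ,
                     (begin
                       a               ≡⟨ sym (ℤ.neg-involutive a) ⟩
                       ℤ.- (ℤ.- a)     ≡⟨ cong ℤ.-_ (sym |a|≡-a) ⟩
                       ℤ.- (+ ∣ a ∣)   ≡⟨ sym (ℤ.-1*i≡-i (+ ∣ a ∣)) ⟩
                       ℤ.-1ℤ ℤ.* + ∣ a ∣ ∎)
  where open ≡-Reasoning

cast-equation : ∀ {d y n x a} → d + y * n ≡ x * a → + d ℤ.+ + y ℤ.* + n ≡ + x ℤ.* + a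
cast-equation {d} {y} {n} {x} {a} eq = begin
  + d ℤ.+ + y ℤ.* + n   ≡⟨ cong (λ z → + d ℤ.+ z) (sym (ℤ.pos-* y n)) ⟩
  + (d + y * n)         ≡⟨ cong +_ eq ⟩
  + (x * a)             ≡⟨ ℤ.pos-* x a ⟩
  + x ℤ.* + a           ∎
  where open ≡-Reasoning

module Congruence (m : ℕ) where

  -- Congruence modulo m, i.e. equality of g^a and g^b in C_m. Wrapping the
  -- relation of Defs in a record lets Agda infer a and b from a proof.
  infix 4 _≈_
  record _≈_ (a b : ℤ) : Set where
    constructor ⟪_⟫
    field unwrap : a ≡[ m ] b
  open _≈_ public

  multiple⇒≈ : ∀ {a b x} → + m ℤ.∣ x → x ≡ a - b → a ≈ b
  multiple⇒≈ m∣x refl = ⟪ ℤ.∣⇒∣ᵤ m∣x ⟫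

  ≈⇒multiple : ∀ {a b} → a ≈ b → + m ℤ.∣ (a - b)
  ≈⇒multiple ⟪ m∣a-b ⟫ = ℤ.∣ᵤ⇒∣ m∣a-b

  ≈-reflexive : ∀ {a b} → a ≡ b → a ≈ b
  ≈-reflexive {a} refl = multiple⇒≈ (ℤ.divides 0ℤ refl) (sym (ℤ.+-inverseʳ a))

  ≈-refl : ∀ {a} → a ≈ a
  ≈-refl = ≈-reflexive refl

  ≈-sym : ∀ {a b} → a ≈ b → b ≈ a
  ≈-sym {a} {b} a≈b = multiple⇒≈ (ℤ.∣m⇒∣-m (≈⇒multiple a≈b)) (negate a b)
    where
    negate : ∀ a b → ℤ.- (a - b) ≡ b - a
    negate = solve-∀

  ≈-trans : ∀ {a b c} → a ≈ b → b ≈ c → a ≈ c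
  ≈-trans {a} {b} {c} a≈b b≈c =
    multiple⇒≈ (ℤ.∣m∣n⇒∣m+n (≈⇒multiple a≈b) (≈⇒multiple b≈c)) (telescope a b c)
    where
    telescope : ∀ a b c → (a - b) ℤ.+ (b - c) ≡ a - c
    telescope = solve-∀

  ≈-setoid : Setoid _ _
  ≈-setoid = record
    { Carrier = ℤ ; _≈_ = _≈_
    ; isEquivalence = record { refl = ≈-refl ; sym = ≈-sym ; trans = ≈-trans } }

  +-cong : ∀ {a b c d} → a ≈ b → c ≈ d → a ℤ.+ c ≈ b ℤ.+ d
  +-cong {a} {b} {c} {d} a≈b c≈d =
    multiple⇒≈ (ℤ.∣m∣n⇒∣m+n (≈⇒multiple a≈b) (≈⇒multiple c≈d)) (interchange a b c d)
    where
    interchange : ∀ a b c d → (a - b) ℤ.+ (c - d) ≡ (a ℤ.+ c) - (b ℤ.+ d)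
    interchange = solve-∀

  *-congˡ : ∀ c {a b} → a ≈ b → c ℤ.* a ≈ c ℤ.* b
  *-congˡ c {a} {b} a≈b = multiple⇒≈ (ℤ.∣n⇒∣m*n c (≈⇒multiple a≈b)) (distrib c a b)
    where
    distrib : ∀ c a b → c ℤ.* (a - b) ≡ c ℤ.* a - c ℤ.* b
    distrib = solve-∀

  *-congʳ : ∀ c {a b} → a ≈ b → a ℤ.* c ≈ b ℤ.* c
  *-congʳ c {a} {b} a≈b = subst₂ _≈_ (ℤ.*-comm c a) (ℤ.*-comm c b) (*-congˡ c a≈b)

  ≈0⇔ : ∀ x → (x ≈ 0ℤ) ⇔ (m ∣ ∣ x ∣)
  ≈0⇔ x = mk⇔ (λ (⟪ h ⟫) → subst (λ y → m ∣ ∣ y ∣) (ℤ.+-identityʳ x) h)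
              (λ h → ⟪ subst (λ y → m ∣ ∣ y ∣) (sym (ℤ.+-identityʳ x)) h ⟫)

  bézout⇒≈ : ∀ {d a} → Bézout.Identity d a m → ∃ λ v → v ℤ.* + a ≈ + d
  bézout⇒≈ {d} {a} (Bézout.+- x y eq) =
    + x , multiple⇒≈ (ℤ.divides (+ y) refl)
            (isolate (+ d) (+ y ℤ.* + m) (+ x ℤ.* + a) (cast-equation {d} {y} {m} {x} {a} eq))
    where
    isolate : ∀ D Y Z → D ℤ.+ Y ≡ Z → Y ≡ Z - D
    isolate D Y _ refl = shift D Y
      where
      shift : ∀ D Y → Y ≡ (D ℤ.+ Y) - D
      shift = solve-∀
  bézout⇒≈ {d} {a} (Bézout.-+ x y eq) =
    ℤ.- + x , multiple⇒≈ (ℤ.∣m⇒∣-m (ℤ.divides (+ y) refl))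
                (isolate (+ d) (+ x) (+ a) (+ y ℤ.* + m) (cast-equation {d} {x} {a} {y} {m} eq))
    where
    isolate : ∀ D X A Z → D ℤ.+ X ℤ.* A ≡ Z → (ℤ.- Z) ≡ (ℤ.- X) ℤ.* A - D
    isolate D X A _ refl = negate D X A
      where
      negate : ∀ D X A → ℤ.- (D ℤ.+ X ℤ.* A) ≡ (ℤ.- X) ℤ.* A - D
      negate = solve-∀

  gcd-as-multiple : ∀ a → ∃ λ v → v ℤ.* a ≈ + gcd (∣ a ∣) m
  gcd-as-multiple a with bézout⇒≈ (Bézout.identity (gcd-GCD ∣ a ∣ m)) | abs-sign a
  ... | v , v|a|≈d | e , |a|≡ea , _ = v ℤ.* e , (begin
    v ℤ.* e ℤ.* a       ≡⟨ ℤ.*-assoc v e a ⟩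
    v ℤ.* (e ℤ.* a)     ≡⟨ cong (v ℤ.*_) (sym |a|≡ea) ⟩
    v ℤ.* + ∣ a ∣       ≈⟨ v|a|≈d ⟩
    + gcd (∣ a ∣) m     ∎)
    where open SetoidReasoning ≈-setoid

  multiple-of-gcd : ∀ r t → gcd (∣ r ∣) m ∣ ∣ t ∣ → ∃ λ i → i ℤ.* r ≈ t
  multiple-of-gcd r t (divides t′ |t|≡t′d) with gcd-as-multiple r | abs-sign t
  ... | v , vr≈d | e , _ , t≡e|t| = e ℤ.* + t′ ℤ.* v , (begin
    e ℤ.* + t′ ℤ.* v ℤ.* r              ≡⟨ ℤ.*-assoc (e ℤ.* + t′) v r ⟩
    e ℤ.* + t′ ℤ.* (v ℤ.* r)            ≈⟨ *-congˡ (e ℤ.* + t′) vr≈d ⟩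
    e ℤ.* + t′ ℤ.* + gcd (∣ r ∣) m      ≡⟨ ℤ.*-assoc e (+ t′) _ ⟩
    e ℤ.* (+ t′ ℤ.* + gcd (∣ r ∣) m)    ≡⟨ cong (e ℤ.*_) (sym (ℤ.pos-* t′ _)) ⟩
    e ℤ.* + (t′ * gcd (∣ r ∣) m)        ≡⟨ cong (λ n → e ℤ.* + n) (sym |t|≡t′d) ⟩
    e ℤ.* + ∣ t ∣                       ≡⟨ sym t≡e|t| ⟩
    t                                   ∎)
    where open SetoidReasoning ≈-setoid

  module Unit (u j : ℤ) (uj≈1 : u ℤ.* j ≈ 1ℤ) where
    u-undoes-j : ∀ x → u ℤ.* (j ℤ.* x) ≈ x
    u-undoes-j x = begin
      u ℤ.* (j ℤ.* x)   ≡⟨ sym (ℤ.*-assoc u j x) ⟩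
      u ℤ.* j ℤ.* x     ≈⟨ *-congʳ x uj≈1 ⟩
      1ℤ ℤ.* x          ≡⟨ ℤ.*-identityˡ x ⟩
      x                 ∎
      where open SetoidReasoning ≈-setoid

    j-undoes-u : ∀ x → j ℤ.* (u ℤ.* x) ≈ x
    j-undoes-u x = ≈-trans (≈-reflexive (swap j u x)) (u-undoes-j x)
      where
      swap : ∀ j u x → j ℤ.* (u ℤ.* x) ≡ u ℤ.* (j ℤ.* x)
      swap = solve-∀

    u·-isAut : IsAut m (u ℤ.*_)
    u·-isAut =
      (λ _ _ a≡b → unwrap (*-congˡ u ⟪ a≡b ⟫)) ,
      (λ a b → unwrap (≈-reflexive (ℤ.*-distribˡ-+ u a b))) ,
      (λ a b ua≡ub → unwrap (≈-trans (≈-sym (j-undoes-u a)) (≈-trans (*-congˡ j ⟪ ua≡ub ⟫) (j-undoes-u b)))) ,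
      (λ b → j ℤ.* b , unwrap (u-undoes-j b))

module Cyclic (m : ℕ) {{m≢0 : NonZero m}} where
  open Congruence m

  order : ℤ → ℕ
  order a = cofactor ∣ a ∣ m

  order-nonZero : ∀ a → NonZero (order a)
  order-nonZero a = cofactor-nonZero ∣ a ∣ m

  order∣⇔ : ∀ a k → (order a ∣ k) ⇔ ((+ k) ℤ.* a ≈ 0ℤ)
  order∣⇔ a k = begin
    (order a ∣ k)             ≈⟨ cofactor∣⇔ ∣ a ∣ m k ⟩
    (m ∣ k * ∣ a ∣)           ≡⟨ cong (m ∣_) (sym (ℤ.abs-* (+ k) a)) ⟩
    (m ∣ ∣ (+ k) ℤ.* a ∣)     ≈⟨ Equiv.sym (≈0⇔ ((+ k) ℤ.* a)) ⟩
    ((+ k) ℤ.* a ≈ 0ℤ)        ∎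
    where open SetoidReasoning (Equiv.⇔-setoid 0ℓ)

  order-isOrder : ∀ a → IsOrder m a (order a)
  order-isOrder a =
    >-nonZero⁻¹ (order a) {{order-nonZero a}} ,
    unwrap (Equivalence.to (order∣⇔ a (order a)) ∣-refl) ,
    λ j j>0 j-kills → ∣⇒≤ {{>-nonZero j>0}} (Equivalence.from (order∣⇔ a j) ⟪ j-kills ⟫)

  isOrder-unique : ∀ {a k n} → IsOrder m a k → IsOrder m a n → k ≡ n
  isOrder-unique (k>0 , k-kills , k-least) (n>0 , n-kills , n-least) =
    ≤-antisym (k-least _ n>0 n-kills) (n-least _ k>0 k-kills)

  isOrder⇒≡order : ∀ {a k} → IsOrder m a k → k ≡ order a
  isOrder⇒≡order k-order = isOrder-unique k-order (order-isOrder _)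

  same-order : ∀ {a b} → (∀ k → (+ k) ℤ.* a ≈ 0ℤ → (+ k) ℤ.* b ≈ 0ℤ) →
               (∀ k → (+ k) ℤ.* b ≈ 0ℤ → (+ k) ℤ.* a ≈ 0ℤ) → order a ≡ order b
  same-order {a} {b} a⇒b b⇒a = same-multiples⇒≡
    (λ k h → Equivalence.from (order∣⇔ b k) (a⇒b k (Equivalence.to (order∣⇔ a k) h)))
    (λ k h → Equivalence.from (order∣⇔ a k) (b⇒a k (Equivalence.to (order∣⇔ b k) h)))

  order-injective : ∀ a b → order a ≡ order b → gcd (∣ a ∣) m ≡ gcd (∣ b ∣) m
  order-injective a b = cofactor≡⇒gcd≡ ∣ a ∣ ∣ b ∣ m

  gcd≡⇒order≡ : ∀ a b → gcd (∣ a ∣) m ≡ gcd (∣ b ∣) m → order a ≡ order b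
  gcd≡⇒order≡ a b = gcd≡⇒cofactor≡ ∣ a ∣ ∣ b ∣ m

  order-cong : ∀ {a b} → a ≈ b → order a ≡ order b
  order-cong {a} {b} a≈b = same-order {a} {b}
    (λ k h → ≈-trans (*-congˡ (+ k) (≈-sym a≈b)) h)
    (λ k h → ≈-trans (*-congˡ (+ k) a≈b) h)

  module Automorphism (f : ℤ → ℤ) (aut : IsAut m f) where
    f-cong : ∀ {a b} → a ≈ b → f a ≈ f b
    f-cong ⟪ a≡b ⟫ = ⟪ proj₁ aut _ _ a≡b ⟫

    f-hom : ∀ a b → f (a ℤ.+ b) ≈ f a ℤ.+ f b
    f-hom a b = ⟪ proj₁ (proj₂ aut) a b ⟫

    f-injective : ∀ {a b} → f a ≈ f b → a ≈ b
    f-injective ⟪ fa≡fb ⟫ = ⟪ proj₁ (proj₂ (proj₂ aut)) _ _ fa≡fb ⟫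

    -- f 0 = f (0 + 0) = f 0 + f 0 forces f 0 = 0.
    f-0 : f 0ℤ ≈ 0ℤ
    f-0 = multiple⇒≈ (≈⇒multiple (≈-sym (f-hom 0ℤ 0ℤ))) (cancel (f 0ℤ))
      where
      cancel : ∀ x → (x ℤ.+ x) - x ≡ x - 0ℤ
      cancel = solve-∀

    f-power : ∀ k a → f ((+ k) ℤ.* a) ≈ (+ k) ℤ.* f a
    f-power zero    a = f-0
    f-power (suc k) a = begin
      f (+ suc k ℤ.* a)           ≡⟨ cong f (ℤ.suc-* (+ k) a) ⟩
      f (a ℤ.+ + k ℤ.* a)         ≈⟨ f-hom a (+ k ℤ.* a) ⟩
      f a ℤ.+ f (+ k ℤ.* a)       ≈⟨ +-cong (≈-refl {f a}) (f-power k a) ⟩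
      f a ℤ.+ + k ℤ.* f a         ≡⟨ sym (ℤ.suc-* (+ k) (f a)) ⟩
      + suc k ℤ.* f a             ∎
      where open SetoidReasoning ≈-setoid

    order-preserved : ∀ a → order (f a) ≡ order a
    order-preserved a = same-order {f a} {a}
      (λ k h → f-injective (≈-trans (f-power k a) (≈-trans h (≈-sym f-0))))
      (λ k h → ≈-trans (≈-sym (f-power k a)) (≈-trans (f-cong h) f-0))

  order-scaled∣⇔ : ∀ i a k → (order (i ℤ.* a) ∣ k) ⇔ (order a ∣ k * ∣ i ∣)
  order-scaled∣⇔ i a k = begin
    (order (i ℤ.* a) ∣ k)       ≈⟨ cofactor∣⇔ ∣ i ℤ.* a ∣ m k ⟩
    (m ∣ k * ∣ i ℤ.* a ∣)       ≡⟨ cong (λ x → m ∣ k * x) (ℤ.abs-* i a) ⟩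
    (m ∣ k * (∣ i ∣ * ∣ a ∣))   ≡⟨ cong (m ∣_) (sym (*-assoc k ∣ i ∣ ∣ a ∣)) ⟩
    (m ∣ k * ∣ i ∣ * ∣ a ∣)     ≈⟨ Equiv.sym (cofactor∣⇔ ∣ a ∣ m (k * ∣ i ∣)) ⟩
    (order a ∣ k * ∣ i ∣)       ∎
    where open SetoidReasoning (Equiv.⇔-setoid 0ℓ)

  coprime⇒order-preserved : ∀ i a → gcd (∣ i ∣) (order a) ≡ 1 → order (i ℤ.* a) ≡ order a
  coprime⇒order-preserved i a i⊥o = same-multiples⇒≡
    (λ k h → coprime⇒cancellable i⊥o k (Equivalence.to (order-scaled∣⇔ i a k) h))
    (λ k h → Equivalence.from (order-scaled∣⇔ i a k) (∣-trans h (m∣m*n ∣ i ∣)))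

  order-preserved⇒coprime : ∀ i a → order (i ℤ.* a) ≡ order a → gcd (∣ i ∣) (order a) ≡ 1
  order-preserved⇒coprime i a same = cancellable⇒coprime ∣ i ∣ (order a) {{order-nonZero a}}
    (λ k h → subst (_∣ k) same (Equivalence.from (order-scaled∣⇔ i a k) h))

  admissible⇔ : ∀ r s i j → Admissible m (r , s) i j ⇔
                (gcd (∣ i ∣) (order r) ≡ 1 × gcd (∣ j ∣) (order s) ≡ 1)
  admissible⇔ r s i j = mk⇔
    (λ (i-adm , j-adm) → i-adm _ (order-isOrder r) , j-adm _ (order-isOrder s))
    (λ (i⊥r , j⊥s) → (λ k k-order → subst (λ o → gcd (∣ i ∣) o ≡ 1) (sym (isOrder⇒≡order k-order)) i⊥r) ,
                     (λ k k-order → subst (λ o → gcd (∣ j ∣) o ≡ 1) (sym (isOrder⇒≡order k-order)) j⊥s))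

  -- An admissible power followed by an automorphism preserves gcd(|r|, m):
  -- the order of g^r is unchanged by both.
  gcd-invariant : ∀ f i r t → IsAut m f → gcd (∣ i ∣) (order r) ≡ 1 → f (i ℤ.* r) ≈ t →
                  gcd (∣ r ∣) m ≡ gcd (∣ t ∣) m
  gcd-invariant f i r t aut i⊥r fir≈t = order-injective r t (begin
    order r             ≡⟨ sym (coprime⇒order-preserved i r i⊥r) ⟩
    order (i ℤ.* r)     ≡⟨ sym (order-preserved (i ℤ.* r)) ⟩
    order (f (i ℤ.* r)) ≡⟨ order-cong fir≈t ⟩
    order t             ∎)
    where
    open ≡-Reasoning
    open Automorphism f aut

  connecting-power : ∀ r t → gcd (∣ r ∣) m ≡ gcd (∣ t ∣) m →
                     ∃ λ i → (i ℤ.* r ≈ t) × (gcd (∣ i ∣) (order r) ≡ 1)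
  connecting-power r t same-gcd = i , ir≈t , order-preserved⇒coprime i r
    (trans (order-cong ir≈t) (gcd≡⇒order≡ t r (sym same-gcd)))
    where
    gcd∣t : gcd (∣ r ∣) m ∣ ∣ t ∣
    gcd∣t = subst (_∣ ∣ t ∣) (sym same-gcd) (gcd[m,n]∣m ∣ t ∣ m)
    i : ℤ
    i = proj₁ (multiple-of-gcd r t gcd∣t)
    ir≈t : i ℤ.* r ≈ t
    ir≈t = proj₂ (multiple-of-gcd r t gcd∣t)

  identity-isAut : IsAut m (λ x → x)
  identity-isAut =
    (λ _ _ a≡b → a≡b) , (λ a b → unwrap (≈-refl {a ℤ.+ b})) , (λ _ _ a≡b → a≡b) , (λ b → b , unwrap (≈-refl {b}))

  reaches⇒ : ∀ r s t q → Reaches m (r , s) (t , q) →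
             (gcd (∣ r ∣) m ≡ gcd (∣ t ∣) m) × (gcd (∣ s ∣) m ≡ gcd (∣ q ∣) m)
  reaches⇒ r s t q (i , j , adm , f , aut , fir≡t , fjs≡q) =
    gcd-invariant f i r t aut (proj₁ coprime) ⟪ fir≡t ⟫ , gcd-invariant f j s q aut (proj₂ coprime) ⟪ fjs≡q ⟫
    where
    coprime : (gcd (∣ i ∣) (order r) ≡ 1) × (gcd (∣ j ∣) (order s) ≡ 1)
    coprime = Equivalence.to (admissible⇔ r s i j) adm

  ⇒reaches : ∀ r s t q → gcd (∣ r ∣) m ≡ gcd (∣ t ∣) m → gcd (∣ s ∣) m ≡ gcd (∣ q ∣) m →
             Reaches m (r , s) (t , q)
  ⇒reaches r s t q same-r same-s =
    i , j , Equivalence.from (admissible⇔ r s i j) (i⊥r , j⊥s) ,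
    (λ x → x) , identity-isAut , unwrap ir≈t , unwrap js≈q
    where
    i = proj₁ (connecting-power r t same-r)
    ir≈t = proj₁ (proj₂ (connecting-power r t same-r))
    i⊥r = proj₂ (proj₂ (connecting-power r t same-r))
    j = proj₁ (connecting-power s q same-s)
    js≈q = proj₁ (proj₂ (connecting-power s q same-s))
    j⊥s = proj₂ (proj₂ (connecting-power s q same-s))

  sameOrbit⇔ : ∀ r s t q → SameOrbit m (𝒞 m r s) (𝒞 m t q) ⇔
               ((gcd (∣ r ∣) m ≡ gcd (∣ t ∣) m) × (gcd (∣ s ∣) m ≡ gcd (∣ q ∣) m))
  sameOrbit⇔ r s t q = mk⇔ to (λ (same-r , same-s) → inj₁ (⇒reaches r s t q same-r same-s))
    where
    to : SameOrbit m (𝒞 m r s) (𝒞 m t q) → (gcd (∣ r ∣) m ≡ gcd (∣ t ∣) m) × (gcd (∣ s ∣) m ≡ gcd (∣ q ∣) m)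
    to (inj₁ forward)  = reaches⇒ r s t q forward
    to (inj₂ backward) = Product.map sym sym (reaches⇒ t q r s backward)

  -- If gcd(|r|, |s|, m) = 1 and j is coprime to the orders of g^r and g^s,
  -- then j is coprime to m: gcd(|j|, m) divides r, s and m.
  coprime-to-orders⇒coprime : ∀ r s j → gcd (gcd (∣ r ∣) (∣ s ∣)) m ≡ 1 →
    gcd (∣ j ∣) (order r) ≡ 1 → gcd (∣ j ∣) (order s) ≡ 1 → gcd (∣ j ∣) m ≡ 1
  coprime-to-orders⇒coprime r s j r,s,m-coprime j⊥r j⊥s = ∣1⇒≡1 (subst (gcd (∣ j ∣) m ∣_) r,s,m-coprime
    (gcd-greatest (gcd-greatest (coprime-to-cofactor⇒gcd∣ ∣ j ∣ ∣ r ∣ m j⊥r)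
                                (coprime-to-cofactor⇒gcd∣ ∣ j ∣ ∣ s ∣ m j⊥s))
                  (gcd[m,n]∣n ∣ j ∣ m)))

  wilson-invariant : ∀ r s → gcd (gcd (∣ r ∣) (∣ s ∣)) m ≡ 1 → ∀ j → Admissible m (r , s) j j →
                     Iso m (j ℤ.* r , j ℤ.* s) (r , s)
  wilson-invariant r s r,s,m-coprime j adm =
    (u ℤ.*_) , u·-isAut , unwrap (u-undoes-j r) , unwrap (u-undoes-j s)
    where
    coprime : (gcd (∣ j ∣) (order r) ≡ 1) × (gcd (∣ j ∣) (order s) ≡ 1)
    coprime = Equivalence.to (admissible⇔ r s j j) adm
    j⊥m : gcd (∣ j ∣) m ≡ 1
    j⊥m = coprime-to-orders⇒coprime r s j r,s,m-coprime (proj₁ coprime) (proj₂ coprime)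
    u : ℤ
    u = proj₁ (gcd-as-multiple j)
    uj≈1 : u ℤ.* j ≈ 1ℤ
    uj≈1 = ≈-trans (proj₂ (gcd-as-multiple j)) (≈-reflexive (cong +_ j⊥m))
    open Unit u j uj≈1

-- Corollary 4.5: the first part is sameOrbit⇔ (it does not need the
-- coprimality hypotheses), the second is wilson-invariant.
corollary4p5 : ((m : ℕ) → 0 < m → (r s t q : ℤ) →
    gcd (gcd (∣ r ∣) (∣ s ∣)) m ≡ 1 → gcd (gcd (∣ t ∣) (∣ q ∣)) m ≡ 1 →
    (SameOrbit m (𝒞 m r s) (𝒞 m t q)
    ⇔ ((gcd (∣ r ∣) m ≡ gcd (∣ t ∣) m) × (gcd (∣ s ∣) m ≡ gcd (∣ q ∣) m))))
    ×
    ((m : ℕ) → 0 < m → (r s : ℤ) → gcd (gcd (∣ r ∣) (∣ s ∣)) m ≡ 1 →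
    (j : ℤ) → Admissible m (𝒞 m r s) j j →
    Iso m (H j j (𝒞 m r s)) (𝒞 m r s))
corollary4p5 =
  (λ m m>0 r s t q _ _ → Cyclic.sameOrbit⇔ m {{>-nonZero m>0}} r s t q) ,
  (λ m m>0 → Cyclic.wilson-invariant m {{>-nonZero m>0}})
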